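{- For a positive integer $k$ let $\tau(k)$ denote the number of positive divisors of $k$, and for positive integers $n$ define $f'(n):=\sum_{1\le k\le n} 2^{\tau(k)}$. Then $$\lim_{n\to\infty} \frac{f'(2n)}{f'(n)}=\infty.$$
   Context: $\tau(k)$ is the number of positive divisors of $k$. -}

module Defs where

open import Data.Nat using (ℕ; suc; _+_; _^_)
open import Data.Nat.Divisibility using (_∣?_)
open import Data.List using (List; upTo; map; filter; length)
open import Data.Nat.ListAction using (sum)

oneTo : ℕ → List ℕ
oneTo n = map suc (upTo n)

τ : ℕ → ℕ
τ k = length (filter (_∣? k) (oneTo k))

f′ : ℕ → ℕ
f′ n = sum (map (λ k → 2 ^ τ k) (oneTo n))

-- Let k maximise τ on 1, …, n and let T(k) count the divisors d of k with 2d ∤ k.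
-- Then f′(n) ≤ n · 2^τ(k), while the divisors of 2k include those of k together
-- with the 2d above, so f′(2n) ≥ 2^τ(2k) ≥ 2^(τ(k) + T(k)); it therefore suffices
-- that 2^T(k) outgrows M · n. Grouping the divisors d of k by the largest i with
-- 2^i d ∣ k gives τ(k) ≤ log₂(k) · T(k), and τ(k) ≥ τ(2^e 3^e 5^e) = (e + 1)³ once
-- 30^e ≤ n. So T(k) is of order (log n)², which beats log n + log M.
module Submission where

open import Defs
open import Data.Nat using (ℕ; suc; _*_; _≤_; _<_)
open import Data.Product using (∃-syntax)

open import Data.Nat using (zero; _+_; _^_; z≤n; s≤s; s≤s⁻¹; NonZero; >-nonZero; ≢-nonZero⁻¹)
open import Data.Nat.Properties
open import Data.Nat.Divisibility
open import Data.Nat.Primality using (Prime; prime?; euclidsLemma; ¬prime[1])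
open import Data.Nat.ListAction using (sum)
open import Data.List using (List; []; _∷_; _++_; map; filter; length; upTo; cartesianProduct)
open import Data.List.Properties using (length-map; length-++; length-upTo; length-removeAt′; filter-all; filter-none)
open import Data.List.Membership.Propositional using (_∈_)
open import Data.List.Membership.Propositional.Properties
open import Data.List.Relation.Binary.Subset.Propositional using (_⊆_)
open import Data.List.Relation.Unary.Any using (here; there; index; _─_)
import Data.List.Relation.Unary.All as All
open import Data.List.Relation.Unary.AllPairs using (_∷_)
open import Data.List.Relation.Unary.Unique.Propositional using (Unique)
import Data.List.Relation.Unary.Unique.Propositional.Properties as Unique
import Data.List.Extrema
open import Data.Product using (_×_; _,_; proj₁; proj₂)
open import Data.Sum using (inj₁; inj₂)
open import Data.Empty using (⊥-elim)
open import Relation.Nullary using (¬_; yes; no; ¬?; contradiction)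
open import Relation.Nullary.Decidable using (from-yes; from-no)
open import Relation.Binary.PropositionalEquality

module _ {a} {A : Set a} where

  ∈-─⁺ : ∀ {x y : A} {ys} (x∈ys : x ∈ ys) → y ∈ ys → x ≢ y → y ∈ (ys ─ x∈ys)
  ∈-─⁺ (here refl)  (here refl)  x≢y = ⊥-elim (x≢y refl)
  ∈-─⁺ (here refl)  (there y∈ys) _   = y∈ys
  ∈-─⁺ (there x∈ys) (here refl)  _   = here refl
  ∈-─⁺ (there x∈ys) (there y∈ys) x≢y = there (∈-─⁺ x∈ys y∈ys x≢y)

  Unique-⊆⇒length≤ : ∀ {xs ys : List A} → Unique xs → xs ⊆ ys → length xs ≤ length ys
  Unique-⊆⇒length≤ {[]}     _              _       = z≤n
  Unique-⊆⇒length≤ {x ∷ xs} {ys} (x∉xs ∷ xs!) x∷xs⊆ys = begin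
    suc (length xs)          ≤⟨ s≤s (Unique-⊆⇒length≤ xs! xs⊆ys─x) ⟩
    suc (length (ys ─ x∈ys)) ≡⟨ sym (length-removeAt′ ys (index x∈ys)) ⟩
    length ys                ∎
    where
    open ≤-Reasoning
    x∈ys : x ∈ ys
    x∈ys = x∷xs⊆ys (here refl)
    xs⊆ys─x : xs ⊆ (ys ─ x∈ys)
    xs⊆ys─x y∈xs = ∈-─⁺ x∈ys (x∷xs⊆ys (there y∈xs)) (All.lookup x∉xs y∈xs)

  length-cartesianProduct : ∀ {b} {B : Set b} (xs : List A) (ys : List B) →
                            length (cartesianProduct xs ys) ≡ length xs * length ys
  length-cartesianProduct []       ys = refl
  length-cartesianProduct (x ∷ xs) ys = begin
    length (map (x ,_) ys ++ cartesianProduct xs ys)     ≡⟨ length-++ (map (x ,_) ys) ⟩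
    length (map (x ,_) ys) + length (cartesianProduct xs ys)
      ≡⟨ cong₂ _+_ (length-map (x ,_) ys) (length-cartesianProduct xs ys) ⟩
    length ys + length xs * length ys                    ∎
    where open ≡-Reasoning

sum-map-≤ : ∀ (h : ℕ → ℕ) {B} xs → (∀ {x} → x ∈ xs → h x ≤ B) → sum (map h xs) ≤ length xs * B
sum-map-≤ h []       _     = z≤n
sum-map-≤ h (x ∷ xs) h≤B = +-mono-≤ (h≤B (here refl)) (sum-map-≤ h xs (λ x∈xs → h≤B (there x∈xs)))

∈⇒≤sum-map : ∀ (h : ℕ → ℕ) {x xs} → x ∈ xs → h x ≤ sum (map h xs)
∈⇒≤sum-map h {xs = _ ∷ xs} (here refl) = m≤m+n _ (sum (map h xs))
∈⇒≤sum-map h {xs = y ∷ _}  (there x∈xs) = ≤-trans (∈⇒≤sum-map h x∈xs) (m≤n+m _ (h y))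

∈-oneTo⁺ : ∀ {x n} → 1 ≤ x → x ≤ n → x ∈ oneTo n
∈-oneTo⁺ {suc x} _ x<n = ∈-map⁺ suc (∈-upTo⁺ x<n)

∈-oneTo⁻ : ∀ {x n} → x ∈ oneTo n → 1 ≤ x × x ≤ n
∈-oneTo⁻ x∈ with ∈-map⁻ suc x∈
... | _ , y∈ , refl = s≤s z≤n , ∈-upTo⁻ y∈

oneTo-unique : ∀ n → Unique (oneTo n)
oneTo-unique n = Unique.map⁺ suc-injective (Unique.upTo⁺ n)

length-oneTo : ∀ n → length (oneTo n) ≡ n
length-oneTo n = trans (length-map suc (upTo n)) (length-upTo n)

n<2^n : ∀ n → n < 2 ^ n
n<2^n zero    = s≤s z≤n
n<2^n (suc n) = +-mono-≤-< (m^n>0 2 n) (≤-trans (n<2^n n) (m≤m+n (2 ^ n) 0))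

floorLog : ∀ b → 1 < b → ∀ m → ∃[ e ] b ^ e ≤ suc m × suc m < b ^ suc e
floorLog b 1<b zero    = 0 , ≤-refl , subst (1 <_) (sym (*-identityʳ b)) 1<b
floorLog b 1<b (suc m) with floorLog b 1<b m
... | e , b^e≤n , n<b^[1+e] with suc (suc m) <? b ^ suc e
...   | yes n+1<b^[1+e] = e , m≤n⇒m≤1+n b^e≤n , n+1<b^[1+e]
...   | no  n+1≮b^[1+e] = suc e , ≤-reflexive (sym n+1≡b^[1+e]) ,
          subst (_< b ^ suc (suc e)) (sym n+1≡b^[1+e]) (^-monoʳ-< b 1<b (n<1+n (suc e)))
  where
  n+1≡b^[1+e] : suc (suc m) ≡ b ^ suc e
  n+1≡b^[1+e] = ≤-antisym n<b^[1+e] (≮⇒≥ n+1≮b^[1+e])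

divisors : ℕ → List ℕ
divisors k = filter (_∣? k) (oneTo k)

∣⇒≥1 : ∀ {d k} .{{_ : NonZero k}} → d ∣ k → 1 ≤ d
∣⇒≥1 {zero}  {k} 0∣k = contradiction (0∣⇒≡0 0∣k) (≢-nonZero⁻¹ k)
∣⇒≥1 {suc d} _       = s≤s z≤n

∈-divisors⁺ : ∀ {d k} .{{_ : NonZero k}} → d ∣ k → d ∈ divisors k
∈-divisors⁺ {k = k} d∣k = ∈-filter⁺ (_∣? k) (∈-oneTo⁺ (∣⇒≥1 d∣k) (∣⇒≤ d∣k)) d∣k

∈-divisors⁻ : ∀ k {d} → d ∈ divisors k → 1 ≤ d × d ∣ k
∈-divisors⁻ k d∈ with ∈-filter⁻ (_∣? k) {xs = oneTo k} d∈
... | d∈oneTo , d∣k = proj₁ (∈-oneTo⁻ d∈oneTo) , d∣k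

divisors-unique : ∀ k → Unique (divisors k)
divisors-unique k = Unique.filter⁺ (_∣? k) (oneTo-unique k)

Unique⇒length≤τ : ∀ {ds k} .{{_ : NonZero k}} → Unique ds → (∀ {d} → d ∈ ds → d ∣ k) →
                  length ds ≤ τ k
Unique⇒length≤τ ds! ds∣k = Unique-⊆⇒length≤ ds! (λ d∈ds → ∈-divisors⁺ (ds∣k d∈ds))

module _ (p : ℕ) .{{_ : NonZero p}} where

  -- the divisors d of k with νₚ(d) = νₚ(k)
  saturatedDivisors : ℕ → List ℕ
  saturatedDivisors k = filter (λ d → ¬? (p * d ∣? k)) (divisors k)

  τ-saturated : ℕ → ℕ
  τ-saturated k = length (saturatedDivisors k)

  ∈-saturatedDivisors⁻ : ∀ k {d} → d ∈ saturatedDivisors k → d ∈ divisors k × ¬ p * d ∣ k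
  ∈-saturatedDivisors⁻ k = ∈-filter⁻ (λ d → ¬? (p * d ∣? k)) {xs = divisors k}

  saturatedDivisors-unique : ∀ k → Unique (saturatedDivisors k)
  saturatedDivisors-unique k = Unique.filter⁺ (λ d → ¬? (p * d ∣? k)) (divisors-unique k)

  τ+τ-saturated≤τ[p*k] : ∀ k .{{_ : NonZero k}} → τ k + τ-saturated k ≤ τ (p * k)
  τ+τ-saturated≤τ[p*k] k = subst (_≤ τ (p * k)) length-ds
    (Unique⇒length≤τ {{m*n≢0 p k}} ds! ds∣pk)
    where
    ds = divisors k ++ map (p *_) (saturatedDivisors k)
    length-ds : length ds ≡ τ k + τ-saturated k
    length-ds = trans (length-++ (divisors k)) (cong (τ k +_) (length-map (p *_) (saturatedDivisors k)))
    disjoint : ∀ {v} → ¬ (v ∈ divisors k × v ∈ map (p *_) (saturatedDivisors k))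
    disjoint (v∈divisors , v∈map) with ∈-map⁻ (p *_) v∈map
    ... | _ , d∈sat , refl = proj₂ (∈-saturatedDivisors⁻ k d∈sat) (proj₂ (∈-divisors⁻ k v∈divisors))
    ds! : Unique ds
    ds! = Unique.++⁺ (divisors-unique k)
      (Unique.map⁺ (*-cancelˡ-≡ _ _ p) (saturatedDivisors-unique k)) disjoint
    ds∣pk : ∀ {v} → v ∈ ds → v ∣ p * k
    ds∣pk v∈ds with ∈-++⁻ (divisors k) v∈ds
    ... | inj₁ v∈divisors = ∣n⇒∣m*n p (proj₂ (∈-divisors⁻ k v∈divisors))
    ... | inj₂ v∈map with ∈-map⁻ (p *_) v∈map
    ...   | _ , d∈sat , refl = *-monoʳ-∣ p (proj₂ (∈-divisors⁻ k (proj₁ (∈-saturatedDivisors⁻ k d∈sat))))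

  -- the divisors of k / p ^ i, as a sublist of the divisors of k
  divisors/p^ : ℕ → ℕ → List ℕ
  divisors/p^ i k = filter (λ d → p ^ i * d ∣? k) (divisors k)

  ∈-divisors/p^⁻ : ∀ i k {d} → d ∈ divisors/p^ i k → d ∈ divisors k × p ^ i * d ∣ k
  ∈-divisors/p^⁻ i k = ∈-filter⁻ (λ d → p ^ i * d ∣? k) {xs = divisors k}

  divisors/p^-unique : ∀ i k → Unique (divisors/p^ i k)
  divisors/p^-unique i k = Unique.filter⁺ (λ d → p ^ i * d ∣? k) (divisors-unique k)

  divisors/p^-zero : ∀ k → divisors/p^ 0 k ≡ divisors k
  divisors/p^-zero k = filter-all (λ d → p ^ 0 * d ∣? k) (All.tabulate λ d∈ →
    subst (_∣ k) (sym (*-identityˡ _)) (proj₂ (∈-divisors⁻ k d∈)))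

  divisors/p^-empty : ∀ L k .{{_ : NonZero k}} → k < p ^ L → divisors/p^ L k ≡ []
  divisors/p^-empty L k k<p^L = filter-none (λ d → p ^ L * d ∣? k) (All.tabulate λ d∈ p^Ld∣k →
    <⇒≱ k<p^L (≤-trans (m≤m*n (p ^ L) _ {{>-nonZero (proj₁ (∈-divisors⁻ k d∈))}}) (∣⇒≤ p^Ld∣k)))

  -- d ↦ p ^ i * d sends the divisors of k / p ^ i not dividing k / p ^ (i + 1)
  -- injectively to saturated divisors
  length-divisors/p^-suc : ∀ i k .{{_ : NonZero k}} →
    length (divisors/p^ i k) ≤ length (divisors/p^ (suc i) k) + τ-saturated k
  length-divisors/p^-suc i k = begin
    length (divisors/p^ i k)                                ≤⟨ Unique-⊆⇒length≤ (divisors/p^-unique i k) split ⟩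
    length (divisors/p^ (suc i) k ++ exact)                 ≡⟨ length-++ (divisors/p^ (suc i) k) ⟩
    length (divisors/p^ (suc i) k) + length exact           ≤⟨ +-monoʳ-≤ _ length-exact ⟩
    length (divisors/p^ (suc i) k) + τ-saturated k          ∎
    where
    open ≤-Reasoning
    instance _ = m^n≢0 p i
    exact = filter (λ d → ¬? (p ^ suc i * d ∣? k)) (divisors/p^ i k)
    split : divisors/p^ i k ⊆ divisors/p^ (suc i) k ++ exact
    split {d} d∈ with p ^ suc i * d ∣? k
    ... | yes p^[1+i]d∣k = ∈-++⁺ˡ (∈-filter⁺ (λ d → p ^ suc i * d ∣? k) (proj₁ (∈-divisors/p^⁻ i k d∈)) p^[1+i]d∣k)
    ... | no  p^[1+i]d∤k = ∈-++⁺ʳ (divisors/p^ (suc i) k) (∈-filter⁺ (λ d → ¬? (p ^ suc i * d ∣? k)) d∈ p^[1+i]d∤k)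
    exact⊆ : map (p ^ i *_) exact ⊆ saturatedDivisors k
    exact⊆ v∈ with ∈-map⁻ (p ^ i *_) v∈
    ... | d , d∈exact , refl with ∈-filter⁻ (λ d → ¬? (p ^ suc i * d ∣? k)) {xs = divisors/p^ i k} d∈exact
    ...   | d∈divisors/p^ , p^[1+i]d∤k = ∈-filter⁺ (λ d → ¬? (p * d ∣? k)) (∈-divisors⁺ p^id∣k)
            (λ pp^id∣k → p^[1+i]d∤k (subst (_∣ k) (sym (*-assoc p (p ^ i) d)) pp^id∣k))
      where p^id∣k = proj₂ (∈-divisors/p^⁻ i k d∈divisors/p^)
    exact-unique : Unique exact
    exact-unique = Unique.filter⁺ (λ d → ¬? (p ^ suc i * d ∣? k)) (divisors/p^-unique i k)
    length-exact : length exact ≤ τ-saturated k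
    length-exact = subst (_≤ τ-saturated k) (length-map (p ^ i *_) exact)
      (Unique-⊆⇒length≤ (Unique.map⁺ (*-cancelˡ-≡ _ _ (p ^ i)) exact-unique) exact⊆)

  τ-telescope : ∀ j k .{{_ : NonZero k}} → τ k ≤ length (divisors/p^ j k) + j * τ-saturated k
  τ-telescope zero    k = ≤-trans (≤-reflexive (cong length (sym (divisors/p^-zero k)))) (m≤m+n _ 0)
  τ-telescope (suc j) k = begin
    τ k                                                     ≤⟨ τ-telescope j k ⟩
    length (divisors/p^ j k) + j * T                        ≤⟨ +-monoˡ-≤ (j * T) (length-divisors/p^-suc j k) ⟩
    length (divisors/p^ (suc j) k) + T + j * T              ≡⟨ +-assoc _ T (j * T) ⟩
    length (divisors/p^ (suc j) k) + suc j * T              ∎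
    where
    open ≤-Reasoning
    T = τ-saturated k

  τ≤L*τ-saturated : ∀ L k .{{_ : NonZero k}} → k < p ^ L → τ k ≤ L * τ-saturated k
  τ≤L*τ-saturated L k k<p^L = subst (λ ds → τ k ≤ length ds + L * τ-saturated k)
    (divisors/p^-empty L k k<p^L) (τ-telescope L k)

-- Regular numbers 2 ^ i * 3 ^ j * 5 ^ l

^*-injective : ∀ p .{{_ : NonZero p}} a b {x y} → ¬ p ∣ x → ¬ p ∣ y →
               p ^ a * x ≡ p ^ b * y → a ≡ b × x ≡ y
^*-injective p zero    zero    {x} {y} _ _ eq = refl , trans (sym (*-identityˡ x)) (trans eq (*-identityˡ y))
^*-injective p zero    (suc b) {x} {y} p∤x _ eq =
  ⊥-elim (p∤x (subst (p ∣_) (trans (sym (*-assoc p _ y)) (trans (sym eq) (*-identityˡ x))) (m∣m*n _)))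
^*-injective p (suc a) zero    {x} {y} _ p∤y eq =
  ⊥-elim (p∤y (subst (p ∣_) (trans (sym (*-assoc p _ x)) (trans eq (*-identityˡ y))) (m∣m*n _)))
^*-injective p (suc a) (suc b) {x} {y} p∤x p∤y eq with ^*-injective p a b p∤x p∤y
  (*-cancelˡ-≡ _ _ p (trans (sym (*-assoc p (p ^ a) x)) (trans eq (*-assoc p (p ^ b) y))))
... | refl , x≡y = refl , x≡y

prime∤^ : ∀ {p q} → Prime p → ¬ p ∣ q → ∀ j → ¬ p ∣ q ^ j
prime∤^ prime-p _ zero p∣1 with ∣1⇒≡1 p∣1
... | refl = ¬prime[1] prime-p
prime∤^ {q = q} prime-p p∤q (suc j) p∣q^[1+j] with euclidsLemma q (q ^ j) prime-p p∣q^[1+j]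
... | inj₁ p∣q   = p∤q p∣q
... | inj₂ p∣q^j = prime∤^ prime-p p∤q j p∣q^j

^-monoʳ-∣ : ∀ p {i e} → i ≤ e → p ^ i ∣ p ^ e
^-monoʳ-∣ p {e = e} z≤n     = 1∣ (p ^ e)
^-monoʳ-∣ p         (s≤s i≤e) = *-monoʳ-∣ p (^-monoʳ-∣ p i≤e)

regular : ℕ × ℕ × ℕ → ℕ
regular (i , j , l) = 2 ^ i * (3 ^ j * 5 ^ l)

2∤3^j*5^l : ∀ j l → ¬ 2 ∣ 3 ^ j * 5 ^ l
2∤3^j*5^l j l 2∣ with euclidsLemma (3 ^ j) (5 ^ l) (from-yes (prime? 2)) 2∣
... | inj₁ 2∣3^j = prime∤^ (from-yes (prime? 2)) (from-no (2 ∣? 3)) j 2∣3^j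
... | inj₂ 2∣5^l = prime∤^ (from-yes (prime? 2)) (from-no (2 ∣? 5)) l 2∣5^l

3∤5^l : ∀ l → ¬ 3 ∣ 5 ^ l
3∤5^l = prime∤^ (from-yes (prime? 3)) (from-no (3 ∣? 5))

regular-injective : ∀ {u v} → regular u ≡ regular v → u ≡ v
regular-injective {i , j , l} {i′ , j′ , l′} eq
  with ^*-injective 2 i i′ (2∤3^j*5^l j l) (2∤3^j*5^l j′ l′) eq
... | refl , eq′ with ^*-injective 3 j j′ (3∤5^l l) (3∤5^l l′) eq′
...   | refl , eq″ with ^*-injective 5 l l′ {1} {1} (from-no (5 ∣? 1)) (from-no (5 ∣? 1)) (cong (_* 1) eq″)
...     | refl , _ = refl

^-distribʳ-* : ∀ m n o → (m * n) ^ o ≡ m ^ o * n ^ o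
^-distribʳ-* m n zero    = refl
^-distribʳ-* m n (suc o) =
  trans (cong (m * n *_) (^-distribʳ-* m n o)) ([m*n]*[o*p]≡[m*o]*[n*p] m n (m ^ o) (n ^ o))

regular≡30^e : ∀ e → regular (e , e , e) ≡ 30 ^ e
regular≡30^e e = begin
  2 ^ e * (3 ^ e * 5 ^ e)  ≡⟨ cong (2 ^ e *_) (sym (^-distribʳ-* 3 5 e)) ⟩
  2 ^ e * 15 ^ e           ≡⟨ sym (^-distribʳ-* 2 15 e) ⟩
  30 ^ e                   ∎
  where open ≡-Reasoning

τ[regular]≥[1+e]³ : ∀ e → suc e * (suc e * suc e) ≤ τ (regular (e , e , e))
τ[regular]≥[1+e]³ e = subst (_≤ τ (regular (e , e , e))) length-ds
  (Unique⇒length≤τ {{>-nonZero (subst (0 <_) (sym (regular≡30^e e)) (m^n>0 30 e))}} ds! ds∣)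
  where
  exps = upTo (suc e)
  triples = cartesianProduct exps (cartesianProduct exps exps)
  ds = map regular triples
  length-ds : length ds ≡ suc e * (suc e * suc e)
  length-ds = begin
    length ds                                                  ≡⟨ length-map regular triples ⟩
    length triples                                             ≡⟨ length-cartesianProduct exps (cartesianProduct exps exps) ⟩
    length exps * length (cartesianProduct exps exps)          ≡⟨ cong (length exps *_) (length-cartesianProduct exps exps) ⟩
    length exps * (length exps * length exps)                  ≡⟨ cong (λ m → m * (m * m)) (length-upTo (suc e)) ⟩
    suc e * (suc e * suc e)                                    ∎
    where open ≡-Reasoning
  ds! : Unique ds
  ds! = Unique.map⁺ {f = regular} regular-injective
    (Unique.cartesianProduct⁺ (Unique.upTo⁺ (suc e)) (Unique.cartesianProduct⁺ (Unique.upTo⁺ (suc e)) (Unique.upTo⁺ (suc e))))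
  ≤e : ∀ {a} → a ∈ exps → a ≤ e
  ≤e a∈ = s≤s⁻¹ (∈-upTo⁻ {n = suc e} a∈)
  ds∣ : ∀ {v} → v ∈ ds → v ∣ regular (e , e , e)
  ds∣ v∈ with ∈-map⁻ regular {xs = triples} v∈
  ... | (i , jl) , ijl∈ , refl with ∈-cartesianProduct⁻ exps (cartesianProduct exps exps) ijl∈
  ...   | i∈ , jl∈ with ∈-cartesianProduct⁻ exps exps jl∈
  ...     | j∈ , l∈ = *-pres-∣ (^-monoʳ-∣ 2 (≤e i∈)) (*-pres-∣ (^-monoʳ-∣ 3 (≤e j∈)) (^-monoʳ-∣ 5 (≤e l∈)))

record τ-Maximiser (n k : ℕ) : Set where
  field
    ∈-range : k ∈ oneTo n
    maximal : ∀ {j} → j ∈ oneTo n → τ j ≤ τ k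

τ-maximiser : ∀ m → ∃[ k ] τ-Maximiser (suc m) k
τ-maximiser m = k , record
  { ∈-range = argmax-all τ {P = _∈ oneTo (suc m)} (∈-oneTo⁺ ≤-refl (s≤s z≤n)) (All.tabulate λ j∈ → j∈)
  ; maximal = All.lookup (f[xs]≤f[argmax] {f = τ} 1 (oneTo (suc m)))
  }
  where
  open Data.List.Extrema ≤-totalOrder using (argmax; argmax-all; f[xs]≤f[argmax])
  k = argmax τ 1 (oneTo (suc m))

f′-doubling : ∀ M {n k} → τ-Maximiser n k → M * n < 2 ^ τ-saturated 2 k → M * f′ n < f′ (2 * n)
f′-doubling M {n} {k} k-max Mn<2^T = begin-strict
  M * f′ n               ≤⟨ *-monoʳ-≤ M f′≤n*2^τ ⟩
  M * (n * 2 ^ τ k)      ≡⟨ sym (*-assoc M n (2 ^ τ k)) ⟩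
  M * n * 2 ^ τ k        <⟨ *-monoˡ-< (2 ^ τ k) {{m^n≢0 2 (τ k)}} Mn<2^T ⟩
  2 ^ T * 2 ^ τ k        ≡⟨ sym (^-distribˡ-+-* 2 T (τ k)) ⟩
  2 ^ (T + τ k)          ≤⟨ ^-monoʳ-≤ 2 (≤-trans (≤-reflexive (+-comm T (τ k))) (τ+τ-saturated≤τ[p*k] 2 k)) ⟩
  2 ^ τ (2 * k)          ≤⟨ ∈⇒≤sum-map (λ j → 2 ^ τ j) 2k∈ ⟩
  f′ (2 * n)             ∎
  where
  open ≤-Reasoning
  open τ-Maximiser k-max
  T = τ-saturated 2 k
  1≤k×k≤n = ∈-oneTo⁻ ∈-range
  instance _ = >-nonZero (proj₁ 1≤k×k≤n)
  f′≤n*2^τ : f′ n ≤ n * 2 ^ τ k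
  f′≤n*2^τ = subst (λ m → f′ n ≤ m * 2 ^ τ k) (length-oneTo n)
    (sum-map-≤ (λ j → 2 ^ τ j) (oneTo n) (λ j∈ → ^-monoʳ-≤ 2 (maximal j∈)))
  2k∈ : 2 * k ∈ oneTo (2 * n)
  2k∈ = ∈-oneTo⁺ (≤-trans (proj₁ 1≤k×k≤n) (m≤m+n k _)) (*-monoʳ-≤ 2 (proj₂ 1≤k×k≤n))

E³≤5ET⇒6E≤T : ∀ {E T} → 30 ≤ E → E * (E * E) ≤ 5 * E * T → 6 * E ≤ T
E³≤5ET⇒6E≤T {E@(suc _)} {T} 30≤E E³≤5ET = *-cancelˡ-≤ 5 (begin
  5 * (6 * E)  ≡⟨ sym (*-assoc 5 6 E) ⟩
  30 * E       ≤⟨ *-monoˡ-≤ E 30≤E ⟩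
  E * E        ≤⟨ *-cancelˡ-≤ E (≤-trans E³≤5ET (≤-reflexive 5ET≡E[5T])) ⟩
  5 * T        ∎)
  where
  open ≤-Reasoning
  5ET≡E[5T] : 5 * E * T ≡ E * (5 * T)
  5ET≡E[5T] = trans (cong (_* T) (*-comm 5 E)) (*-assoc E 5 T)

τ-saturated-large : ∀ {e n k} → 30 ≤ suc e → 30 ^ e ≤ n → n < 2 ^ (5 * suc e) →
                    τ-Maximiser n k → 6 * suc e ≤ τ-saturated 2 k
τ-saturated-large {e} {n} {k} 30≤E 30^e≤n n<2^5E k-max = E³≤5ET⇒6E≤T 30≤E (begin
  suc e * (suc e * suc e)  ≤⟨ τ[regular]≥[1+e]³ e ⟩
  τ (regular (e , e , e))  ≤⟨ maximal (∈-oneTo⁺ 1≤regular (subst (_≤ n) (sym (regular≡30^e e)) 30^e≤n)) ⟩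
  τ k                      ≤⟨ τ≤L*τ-saturated 2 (5 * suc e) k (≤-<-trans (proj₂ 1≤k×k≤n) n<2^5E) ⟩
  5 * suc e * τ-saturated 2 k ∎)
  where
  open ≤-Reasoning
  open τ-Maximiser k-max
  1≤k×k≤n = ∈-oneTo⁻ ∈-range
  instance _ = >-nonZero (proj₁ 1≤k×k≤n)
  1≤regular : 1 ≤ regular (e , e , e)
  1≤regular = subst (1 ≤_) (sym (regular≡30^e e)) (m^n>0 30 e)

f′-gap : ∀ {M} e {n k} → 30 + M ≤ suc e → 32 ^ e ≤ n → n < 32 ^ suc e → τ-Maximiser n k →
         M * f′ n < f′ (2 * n)
f′-gap {M} e {n} {k} 30+M≤E 32^e≤n n<32^E k-max = f′-doubling M k-max (begin-strict
  M * n                   <⟨ *-mono-< (<-≤-trans (n<2^n M) (^-monoʳ-≤ 2 (≤-trans (m≤n+m M 30) 30+M≤E))) n<2^5E ⟩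
  2 ^ E * 2 ^ (5 * E)     ≡⟨ sym (^-distribˡ-+-* 2 E (5 * E)) ⟩
  2 ^ (6 * E)             ≤⟨ ^-monoʳ-≤ 2 (τ-saturated-large 30≤E 30^e≤n n<2^5E k-max) ⟩
  2 ^ τ-saturated 2 k     ∎)
  where
  open ≤-Reasoning
  E = suc e
  30≤E : 30 ≤ E
  30≤E = ≤-trans (m≤m+n 30 M) 30+M≤E
  30^e≤n : 30 ^ e ≤ n
  30^e≤n = ≤-trans (^-monoˡ-≤ e (≤-trans (n≤1+n 30) (n≤1+n 31))) 32^e≤n
  n<2^5E : n < 2 ^ (5 * E)
  n<2^5E = subst (n <_) (^-*-assoc 2 5 E) n<32^E

-- The exponent c is kept abstract: normalising 32 ^ (30 + M) would build a term of size 32 ^ 30.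
eventually-f′-gap : ∀ M c → 30 + M ≤ c → ∀ n → 32 ^ c ≤ n → M * f′ n < f′ (2 * n)
eventually-f′-gap M c 30+M≤c zero    32^c≤0 = contradiction 32^c≤0 (<⇒≱ (m^n>0 32 c))
eventually-f′-gap M c 30+M≤c (suc m) 32^c≤n =
  let e , 32^e≤n , n<32^[1+e] = floorLog 32 (s≤s (s≤s z≤n)) m
      k , k-max = τ-maximiser m
      c<1+e = ≰⇒> λ 1+e≤c → <⇒≱ n<32^[1+e] (≤-trans (^-monoʳ-≤ 32 1+e≤c) 32^c≤n)
  in f′-gap e (≤-trans 30+M≤c (<⇒≤ c<1+e)) 32^e≤n n<32^[1+e] k-max

theorem1 : ∀ (M : ℕ) → ∃[ N ] (∀ (n : ℕ) → N ≤ n → M * f′ n < f′ (2 * n))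
theorem1 M = 32 ^ (30 + M) , eventually-f′-gap M (30 + M) ≤-refl
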